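{- For every $n\ge0$ and every $w\in\mathfrak{H}$ we have $\rho_{n+1}(w)=\rho_n(zw)$.
   Context: Let $\mathfrak{H}=\mathbb{Q}\langle x,y\rangle$ be the noncommutative polynomial algebra over $\mathbb{Q}$ in $x,y$, and $z=x+y$. For $n\ge0$, make $\mathfrak{H}^{\otimes(n+2)}$ an $\mathfrak{H}$-bimodule via $a\diamond(w_1\otimes\cdots\otimes w_{n+2})\diamond b=w_1b\otimes w_2\otimes\cdots\otimes w_{n+1}\otimes aw_{n+2}$. Let $\mathcal{C}_n\colon\mathfrak{H}\to\mathfrak{H}^{\otimes(n+2)}$ be the $\mathbb{Q}$-linear map with $\mathcal{C}_n(1)=0$, $\mathcal{C}_n(x)=x\otimes z^{\otimes n}\otimes y$, $\mathcal{C}_n(y)=-x\otimes z^{\otimes n}\otimes y$, and $\mathcal{C}_n(ww')=\mathcal{C}_n(w)\diamond w'+w\diamond\mathcal{C}_n(w')$. Let $M_n(w_1\otimes\cdots\otimes w_{n+2})=w_1\cdots w_{n+2}$ and $\rho_n=M_n\circ\mathcal{C}_n$. -}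

module Defs where

open import Data.Rational using (ℚ; 0ℚ; 1ℚ; _+_; _*_; -_)
open import Data.List using (List; []; _∷_; _++_; map; concatMap; foldr)
open import Data.Vec using (Vec; []; _∷_)
open import Data.Product using (_×_; _,_)
open import Data.Nat using (ℕ; zero; suc)
open import Relation.Binary.PropositionalEquality using (_≡_; refl)
open import Relation.Nullary using (Dec; yes; no)
import Data.List.Properties as LP

data Letter : Set where
  x y : Letter

_≟L_ : (a b : Letter) → Dec (a ≡ b)
x ≟L x = yes refl
x ≟L y = no (λ ())
y ≟L x = no (λ ())
y ≟L y = yes refl

Word : Set
Word = List Letter

_≟W_ : (u v : Word) → Dec (u ≡ v)
_≟W_ = LP.≡-dec _≟L_

Lin : Set → Set
Lin B = List (ℚ × B)

scale : {B : Set} → ℚ → Lin B → Lin B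
scale c = map (λ { (d , b) → (c * d , b) })

-- 𝔥 = ℚ⟨x,y⟩ : free ℚ-module on words.
𝔥 : Set
𝔥 = Lin Word

coeff : 𝔥 → Word → ℚ
coeff [] u = 0ℚ
coeff ((c , w) ∷ p) u with w ≟W u
... | yes _ = c + coeff p u
... | no  _ = coeff p u

_≈_ : 𝔥 → 𝔥 → Set
p ≈ q = ∀ u → coeff p u ≡ coeff q u

-- z · p  where z = x + y
zmul : 𝔥 → 𝔥
zmul = concatMap (λ { (c , w) → (c , x ∷ w) ∷ (c , y ∷ w) ∷ [] })

-- 𝔥^{⊗(n+2)} : free ℚ-module on tuples (w₁, (w₂,…,w_{n+1}), w_{n+2}) of words.
TBasis : ℕ → Set
TBasis n = Word × Vec Word n × Word

Tensor : ℕ → Set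
Tensor n = Lin (TBasis n)

-- bimodule actions on basis tensors: a ⋄ (w₁⊗…⊗w_{n+2}) ⋄ b = w₁b ⊗ … ⊗ a w_{n+2}
actR : {n : ℕ} → Word → TBasis n → TBasis n
actR b (w₁ , v , w₂) = (w₁ ++ b , v , w₂)

actL : {n : ℕ} → Word → TBasis n → TBasis n
actL a (w₁ , v , w₂) = (w₁ , v , a ++ w₂)

-- z^{⊗n} expanded in the word basis
zpow : (n : ℕ) → Lin (Vec Word n)
zpow zero = (1ℚ , []) ∷ []
zpow (suc n) = concatMap (λ { (c , v) → (c , (x ∷ []) ∷ v) ∷ (c , (y ∷ []) ∷ v) ∷ [] }) (zpow n)

xzy : (n : ℕ) → Tensor n
xzy n = map (λ { (c , v) → (c , (x ∷ [] , v , y ∷ [])) }) (zpow n)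

𝒞gen : (n : ℕ) → Letter → Tensor n
𝒞gen n x = xzy n
𝒞gen n y = scale (- 1ℚ) (xzy n)

-- 𝒞ₙ on words, via the Leibniz rule 𝒞(a w') = 𝒞(a) ⋄ w' + a ⋄ 𝒞(w'), 𝒞(1) = 0
𝒞word : (n : ℕ) → Word → Tensor n
𝒞word n [] = []
𝒞word n (a ∷ w) = map (λ { (c , t) → (c , actR w t) }) (𝒞gen n a)
               ++ map (λ { (c , t) → (c , actL (a ∷ []) t) }) (𝒞word n w)

𝒞 : (n : ℕ) → 𝔥 → Tensor n
𝒞 n = concatMap (λ { (c , w) → scale c (𝒞word n w) })

concatV : {n : ℕ} → Vec Word n → Word
concatV [] = []
concatV (w ∷ v) = w ++ concatV v

M : (n : ℕ) → Tensor n → 𝔥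
M n = map (λ { (c , (w₁ , v , w₂)) → (c , w₁ ++ concatV v ++ w₂) })

ρ : (n : ℕ) → 𝔥 → 𝔥
ρ n p = M n (𝒞 n p)

module Submission where

open import Defs
open import Data.Nat using (ℕ; zero; suc)
open import Data.Rational using (ℚ; 0ℚ; 1ℚ; _+_; _*_; -_)
import Data.Rational.Properties as ℚ
open import Data.Rational.Solver using (module +-*-Solver)
open import Data.List using ([]; _∷_; [_]; _++_; map; concatMap)
import Data.List.Properties as List
open import Data.Product using (_,_)
open import Data.Vec using (Vec; _∷_)
open import Function using (_∘_)
open import Relation.Binary.Bundles using (Setoid)
open import Relation.Binary.PropositionalEquality as ≡ using (_≡_; refl; cong)
open import Relation.Nullary using (yes; no)
import Relation.Binary.Reasoning.Setoid as SetoidReasoning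

open +-*-Solver

-- Writing w = a₁⋯aₖ, the Leibniz rule gives
--   ρₙ(w) = Σᵢ s(aᵢ) · x aᵢ₊₁⋯aₖ zⁿ a₁⋯aᵢ₋₁ y,   s(x) = 1, s(y) = −1,
-- so the letters before position i are pushed to the right of zⁿ. In
-- ρₙ(zw) = ρₙ(xw) + ρₙ(yw) the two terms with i = 1 cancel since 𝒞(y) = −𝒞(x),
-- and in every other term the new first letter sits right after zⁿ; summing it
-- over {x, y} turns zⁿ into zⁿ z = zⁿ⁺¹, which is ρₙ₊₁(w).

coeff-++ : ∀ (p q : 𝔥) u → coeff (p ++ q) u ≡ coeff p u + coeff q u
coeff-++ [] q u = ≡.sym (ℚ.+-identityˡ _)
coeff-++ ((c , w) ∷ p) q u with w ≟W u
... | yes _ = ≡.trans (cong (c +_) (coeff-++ p q u)) (≡.sym (ℚ.+-assoc c _ _))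
... | no  _ = coeff-++ p q u

coeff-scale : ∀ c (p : 𝔥) u → coeff (scale c p) u ≡ c * coeff p u
coeff-scale c [] u = ≡.sym (ℚ.*-zeroʳ c)
coeff-scale c ((d , w) ∷ p) u with w ≟W u
... | yes _ = ≡.trans (cong (c * d +_) (coeff-scale c p u)) (≡.sym (ℚ.*-distribˡ-+ c d _))
... | no  _ = coeff-scale c p u

-- A record rather than Defs' _≈_, which unfolds to a Π-type and so would not
-- let Agda infer its two sides from a proof.
infix 4 _≋_
record _≋_ (p q : 𝔥) : Set where
  constructor coeffwise
  field coeffs : p ≈ q
open _≋_

≋-setoid : Setoid _ _
≋-setoid = record
  { Carrier       = 𝔥
  ; _≈_           = _≋_
  ; isEquivalence = record
    { refl  = coeffwise λ _ → refl
    ; sym   = λ (coeffwise p≈q) → coeffwise λ u → ≡.sym (p≈q u)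
    ; trans = λ (coeffwise p≈q) (coeffwise q≈r) → coeffwise λ u → ≡.trans (p≈q u) (q≈r u)
    }
  }

open Setoid ≋-setoid using () renaming (refl to ≋-refl; reflexive to ≋-reflexive; trans to ≋-trans)
open SetoidReasoning ≋-setoid

++-cong : ∀ {p p′ q q′ : 𝔥} → p ≋ p′ → q ≋ q′ → p ++ q ≋ p′ ++ q′
++-cong {p} {p′} {q} {q′} (coeffwise p≈p′) (coeffwise q≈q′) = coeffwise λ u →
  ≡.trans (coeff-++ p q u) (≡.trans (≡.cong₂ _+_ (p≈p′ u) (q≈q′ u)) (≡.sym (coeff-++ p′ q′ u)))

++-comm : ∀ (p q : 𝔥) → p ++ q ≋ q ++ p
++-comm p q = coeffwise λ u →
  ≡.trans (coeff-++ p q u) (≡.trans (ℚ.+-comm (coeff p u) _) (≡.sym (coeff-++ q p u)))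

++-inverseʳ : ∀ (p : 𝔥) → p ++ scale (- 1ℚ) p ≋ []
++-inverseʳ p = coeffwise λ u →
  ≡.trans (coeff-++ p _ u) (≡.trans (cong (coeff p u +_) (coeff-scale (- 1ℚ) p u))
    (solve 1 (λ a → a :+ (:- con 1ℚ) :* a := con 0ℚ) refl (coeff p u)))

++-leftComm : ∀ (p q r : 𝔥) → p ++ (q ++ r) ≋ q ++ (p ++ r)
++-leftComm p q r = begin
  p ++ (q ++ r)  ≡⟨ List.++-assoc p q r ⟨
  (p ++ q) ++ r  ≈⟨ ++-cong (++-comm p q) ≋-refl ⟩
  (q ++ p) ++ r  ≡⟨ List.++-assoc q p r ⟩
  q ++ (p ++ r)  ∎

++-interchange : ∀ (p q r s : 𝔥) → (p ++ q) ++ (r ++ s) ≋ (p ++ r) ++ (q ++ s)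
++-interchange p q r s = begin
  (p ++ q) ++ (r ++ s)  ≡⟨ List.++-assoc p q (r ++ s) ⟩
  p ++ (q ++ (r ++ s))  ≈⟨ ++-cong (≋-refl {p}) (++-leftComm q r s) ⟩
  p ++ (r ++ (q ++ s))  ≡⟨ List.++-assoc p r (q ++ s) ⟨
  (p ++ r) ++ (q ++ s)  ∎

++-cancel-scale : ∀ (p q r : 𝔥) → (p ++ q) ++ (scale (- 1ℚ) p ++ r) ≋ q ++ r
++-cancel-scale p q r = begin
  (p ++ q) ++ (scale (- 1ℚ) p ++ r)  ≈⟨ ++-interchange p q (scale (- 1ℚ) p) r ⟩
  (p ++ scale (- 1ℚ) p) ++ (q ++ r)  ≈⟨ ++-cong (++-inverseʳ p) ≋-refl ⟩
  q ++ r                             ∎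

scale-cong : ∀ c {p q : 𝔥} → p ≋ q → scale c p ≋ scale c q
scale-cong c {p} {q} (coeffwise p≈q) = coeffwise λ u →
  ≡.trans (coeff-scale c p u) (≡.trans (cong (c *_) (p≈q u)) (≡.sym (coeff-scale c q u)))

mapConcat : ∀ {n} → (Word → Word) → Lin (Vec Word n) → 𝔥
mapConcat f = map (λ (c , v) → (c , f (concatV v)))

mapZpow : ℕ → (Word → Word) → 𝔥
mapZpow n f = mapConcat f (zpow n)

mapZpow-cong : ∀ n {f g : Word → Word} → (∀ u → f u ≡ g u) → mapZpow n f ≡ mapZpow n g
mapZpow-cong n f≗g = List.map-cong (λ (c , v) → cong (c ,_) (f≗g (concatV v))) (zpow n)

mapZpow-sucˡ : ∀ n f → mapZpow (suc n) f ≋ mapZpow n (f ∘ (x ∷_)) ++ mapZpow n (f ∘ (y ∷_))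
mapZpow-sucˡ n f = split (zpow n)
  where
  split : (l : Lin (Vec Word n)) →
          mapConcat f (concatMap (λ (c , v) → (c , (x ∷ []) ∷ v) ∷ (c , (y ∷ []) ∷ v) ∷ []) l)
          ≋ mapConcat (f ∘ (x ∷_)) l ++ mapConcat (f ∘ (y ∷_)) l
  split [] = ≋-refl
  split ((c , v) ∷ l) = ++-cong (≋-refl {[ (c , f (x ∷ concatV v)) ]})
    (≋-trans (++-cong (≋-refl {[ (c , f (y ∷ concatV v)) ]}) (split l))
             (++-leftComm [ (c , f (y ∷ concatV v)) ] (mapConcat (f ∘ (x ∷_)) l) _))

-- zⁿ⁺¹ = zⁿ z: zpow peels letters off on the left, this lemma on the right.
mapZpow-sucʳ : ∀ n f →
  mapZpow (suc n) f ≋ mapZpow n (λ u → f (u ++ x ∷ [])) ++ mapZpow n (λ u → f (u ++ y ∷ []))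
mapZpow-sucʳ zero    f = ≋-refl
mapZpow-sucʳ (suc n) f = begin
  mapZpow (suc (suc n)) f
    ≈⟨ mapZpow-sucˡ (suc n) f ⟩
  mapZpow (suc n) (f ∘ (x ∷_)) ++ mapZpow (suc n) (f ∘ (y ∷_))
    ≈⟨ ++-cong (mapZpow-sucʳ n (f ∘ (x ∷_))) (mapZpow-sucʳ n (f ∘ (y ∷_))) ⟩
  (mapZpow n (λ u → f (x ∷ u ++ x ∷ [])) ++ mapZpow n (λ u → f (x ∷ u ++ y ∷ [])))
    ++ (mapZpow n (λ u → f (y ∷ u ++ x ∷ [])) ++ mapZpow n (λ u → f (y ∷ u ++ y ∷ [])))
    ≈⟨ ++-interchange (mapZpow n (λ u → f (x ∷ u ++ x ∷ []))) _ _ _ ⟩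
  (mapZpow n (λ u → f (x ∷ u ++ x ∷ [])) ++ mapZpow n (λ u → f (y ∷ u ++ x ∷ [])))
    ++ (mapZpow n (λ u → f (x ∷ u ++ y ∷ [])) ++ mapZpow n (λ u → f (y ∷ u ++ y ∷ [])))
    ≈⟨ ++-cong (mapZpow-sucˡ n (λ u → f (u ++ x ∷ []))) (mapZpow-sucˡ n (λ u → f (u ++ y ∷ []))) ⟨
  mapZpow (suc n) (λ u → f (u ++ x ∷ [])) ++ mapZpow (suc n) (λ u → f (u ++ y ∷ []))
    ∎

mapZpow-suc-infix : ∀ n (r s : Word) →
  mapZpow (suc n) (λ u → r ++ u ++ s) ≋
    mapZpow n (λ u → r ++ u ++ x ∷ s) ++ mapZpow n (λ u → r ++ u ++ y ∷ s)
mapZpow-suc-infix n r s = ≋-trans (mapZpow-sucʳ n (λ u → r ++ u ++ s))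
  (++-cong (≋-reflexive (mapZpow-cong n (λ u → cong (r ++_) (List.++-assoc u (x ∷ []) s))))
           (≋-reflexive (mapZpow-cong n (λ u → cong (r ++_) (List.++-assoc u (y ∷ []) s)))))

Mins : (n : ℕ) → Word → Tensor n → 𝔥
Mins n p = map (λ (c , (w₁ , v , w₂)) → (c , w₁ ++ concatV v ++ p ++ w₂))

M≡Mins[] : ∀ n (t : Tensor n) → M n t ≡ Mins n [] t
M≡Mins[] n = List.map-cong (λ _ → refl)

signed : Letter → 𝔥 → 𝔥
signed x p = p
signed y p = scale (- 1ℚ) p

signed-++ : ∀ a (p q : 𝔥) → signed a (p ++ q) ≡ signed a p ++ signed a q
signed-++ x p q = refl
signed-++ y p q = List.map-++ _ p q

signed-cong : ∀ a {p q : 𝔥} → p ≋ q → signed a p ≋ signed a q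
signed-cong x p≋q = p≋q
signed-cong y p≋q = scale-cong (- 1ℚ) p≋q

Mins-𝒞word-cons : ∀ n a w p → Mins n p (𝒞word n (a ∷ w)) ≡
  signed a (mapZpow n (λ u → x ∷ w ++ u ++ p ++ y ∷ [])) ++ Mins n (p ++ a ∷ []) (𝒞word n w)
Mins-𝒞word-cons n a w p = ≡.trans (List.map-++ _ (map _ (𝒞gen n a)) _)
  (≡.cong₂ _++_ (generator a) (≡.trans (≡.sym (List.map-∘ (𝒞word n w)))
    (List.map-cong (λ (c , (w₁ , v , w₂)) →
      cong (λ s → (c , w₁ ++ concatV v ++ s)) (≡.sym (List.++-assoc p (a ∷ []) w₂))) (𝒞word n w))))
  where
  generator : ∀ a → Mins n p (map (λ (c , t) → (c , actR w t)) (𝒞gen n a)) ≡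
                    signed a (mapZpow n (λ u → x ∷ w ++ u ++ p ++ y ∷ []))
  generator x = ≡.trans (≡.sym (List.map-∘ (xzy n))) (≡.sym (List.map-∘ (zpow n)))
  generator y = ≡.trans (≡.sym (List.map-∘ (scale (- 1ℚ) (xzy n))))
    (≡.trans (≡.sym (List.map-∘ (xzy n))) (≡.trans (≡.sym (List.map-∘ (zpow n))) (List.map-∘ (zpow n))))

Mins-𝒞word-suc : ∀ n w p →
  Mins (suc n) p (𝒞word (suc n) w) ≋ Mins n (x ∷ p) (𝒞word n w) ++ Mins n (y ∷ p) (𝒞word n w)
Mins-𝒞word-suc n []      p = ≋-refl
Mins-𝒞word-suc n (a ∷ w) p = begin
  Mins (suc n) p (𝒞word (suc n) (a ∷ w))
    ≡⟨ Mins-𝒞word-cons (suc n) a w p ⟩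
  signed a (mapZpow (suc n) (λ u → x ∷ w ++ u ++ p ++ y ∷ [])) ++ Mins (suc n) (p ++ a ∷ []) (𝒞word (suc n) w)
    ≈⟨ ++-cong (signed-cong a (mapZpow-suc-infix n (x ∷ w) (p ++ y ∷ [])))
               (Mins-𝒞word-suc n w (p ++ a ∷ [])) ⟩
  signed a (Zx ++ Zy) ++ (Wx ++ Wy)
    ≡⟨ cong (_++ (Wx ++ Wy)) (signed-++ a Zx Zy) ⟩
  (signed a Zx ++ signed a Zy) ++ (Wx ++ Wy)
    ≈⟨ ++-interchange (signed a Zx) (signed a Zy) Wx Wy ⟩
  (signed a Zx ++ Wx) ++ (signed a Zy ++ Wy)
    ≡⟨ ≡.cong₂ _++_ (Mins-𝒞word-cons n a w (x ∷ p)) (Mins-𝒞word-cons n a w (y ∷ p)) ⟨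
  Mins n (x ∷ p) (𝒞word n (a ∷ w)) ++ Mins n (y ∷ p) (𝒞word n (a ∷ w))
    ∎
  where
  Zx = mapZpow n (λ u → x ∷ w ++ u ++ x ∷ p ++ y ∷ [])
  Zy = mapZpow n (λ u → x ∷ w ++ u ++ y ∷ p ++ y ∷ [])
  Wx = Mins n (x ∷ p ++ a ∷ []) (𝒞word n w)
  Wy = Mins n (y ∷ p ++ a ∷ []) (𝒞word n w)

-- The terms coming from the first letter of x ∷ w and y ∷ w cancel.
M-𝒞word-suc : ∀ n w → M (suc n) (𝒞word (suc n) w) ≋ M n (𝒞word n (x ∷ w)) ++ M n (𝒞word n (y ∷ w))
M-𝒞word-suc n w = begin
  M (suc n) (𝒞word (suc n) w)
    ≡⟨ M≡Mins[] (suc n) (𝒞word (suc n) w) ⟩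
  Mins (suc n) [] (𝒞word (suc n) w)
    ≈⟨ Mins-𝒞word-suc n w [] ⟩
  Mins n (x ∷ []) (𝒞word n w) ++ Mins n (y ∷ []) (𝒞word n w)
    ≈⟨ ++-cancel-scale Z _ _ ⟨
  (Z ++ Mins n (x ∷ []) (𝒞word n w)) ++ (scale (- 1ℚ) Z ++ Mins n (y ∷ []) (𝒞word n w))
    ≡⟨ ≡.cong₂ _++_ (Mins-𝒞word-cons n x w []) (Mins-𝒞word-cons n y w []) ⟨
  Mins n [] (𝒞word n (x ∷ w)) ++ Mins n [] (𝒞word n (y ∷ w))
    ≡⟨ ≡.cong₂ _++_ (M≡Mins[] n (𝒞word n (x ∷ w))) (M≡Mins[] n (𝒞word n (y ∷ w))) ⟨
  M n (𝒞word n (x ∷ w)) ++ M n (𝒞word n (y ∷ w))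
    ∎
  where
  Z = mapZpow n (λ u → x ∷ w ++ u ++ y ∷ [])

ρ-cons : ∀ n c w p → ρ n ((c , w) ∷ p) ≡ scale c (M n (𝒞word n w)) ++ ρ n p
ρ-cons n c w p = ≡.trans (List.map-++ _ (scale c (𝒞word n w)) (𝒞 n p))
  (cong (_++ ρ n p) (≡.trans (≡.sym (List.map-∘ (𝒞word n w))) (List.map-∘ (𝒞word n w))))

ρ-suc : ∀ n (w : 𝔥) → ρ (suc n) w ≋ ρ n (zmul w)
ρ-suc n []            = ≋-refl
ρ-suc n ((c , w) ∷ p) = begin
  ρ (suc n) ((c , w) ∷ p)
    ≡⟨ ρ-cons (suc n) c w p ⟩
  scale c (M (suc n) (𝒞word (suc n) w)) ++ ρ (suc n) p
    ≈⟨ ++-cong (scale-cong c (M-𝒞word-suc n w)) (ρ-suc n p) ⟩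
  scale c (Mx ++ My) ++ ρ n (zmul p)
    ≡⟨ cong (_++ ρ n (zmul p)) (List.map-++ _ Mx My) ⟩
  (scale c Mx ++ scale c My) ++ ρ n (zmul p)
    ≡⟨ List.++-assoc (scale c Mx) (scale c My) (ρ n (zmul p)) ⟩
  scale c Mx ++ (scale c My ++ ρ n (zmul p))
    ≡⟨ ≡.trans (ρ-cons n c (x ∷ w) ((c , y ∷ w) ∷ zmul p))
               (cong (scale c Mx ++_) (ρ-cons n c (y ∷ w) (zmul p))) ⟨
  ρ n (zmul ((c , w) ∷ p))
    ∎
  where
  Mx = M n (𝒞word n (x ∷ w))
  My = M n (𝒞word n (y ∷ w))

proposition4p5 : (n : ℕ) (w : 𝔥) → ρ (suc n) w ≈ ρ n (zmul w)
proposition4p5 n w = coeffs (ρ-suc n w)
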